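{- Let $\Lambda$ be a multiset of nonnegative integers containing $0$ exactly once, with finite multiplicities $\lambda_i$ and $\Lambda(z)=\sum_i\lambda_iz^i$ ($\lambda_0=1$), $\lambda_1>0$. For $\Lambda$-row-Fishburn matrices, with $z$ marking the matrix size and $v$ marking a statistic (so that $[z^nv^m]$ is the number of such matrices of size $n$ with statistic equal to $m$), the bivariate generating functions are: (i) for the size of the first row: $1+\sum_{k\ge0}\bigl(\Lambda(vz)^{k+1}-1\bigr)\prod_{1\le j\le k}\bigl(\Lambda(z)^j-1\bigr)$; (ii) for the size of the main diagonal (or of the last column): $\sum_{k\ge0}\prod_{1\le j\le k}\bigl(\Lambda(vz)\Lambda(z)^{j-1}-1\bigr)$; (iii) for the number of entries equal to $1$: $\sum_{k\ge0}\prod_{1\le j\le k}\bigl((\Lambda(z)+\lambda_1(v-1)z)^j-1\bigr)$.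
   Context: An entry of value $i$ may be chosen in $\lambda_i$ distinguishable ways. A $\Lambda$-row-Fishburn matrix is an upper-triangular square matrix (including the empty one) with entries from $\Lambda$ and no row consisting only of zeros. Sizes of a matrix, row, column or diagonal are the sums of the corresponding entries. -}

module Defs where

open import Data.Nat using (ℕ; zero; suc; _+_; _∸_; _≡ᵇ_)
open import Data.Integer as ℤ using (ℤ; +_; 0ℤ; 1ℤ)
open import Data.Fin using (Fin)
open import Data.Vec using (Vec; []; _∷_; head; last)
open import Data.Product using (Σ; _×_; _,_; proj₁)
open import Data.Bool using (Bool; true; false; not; T; if_then_else_; _∧_)
open import Data.Unit using (⊤; tt)
open import Relation.Binary.PropositionalEquality using (_≡_)
open import Function.Bundles using (_↔_)

-- Λ is given by its multiplicity function: λ i = number of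
-- distinguishable ways to choose an entry of value i.

Multiplicity : Set
Multiplicity = ℕ → ℕ

Entry : Multiplicity → Set
Entry Λ = Σ ℕ (λ i → Fin (Λ i))

value : ∀ {Λ} → Entry Λ → ℕ
value = proj₁

-- Upper-triangular d×d matrix, stored row by row: the first row is the
-- vector of its entries in columns 1..d (a Vec of length d), followed by
-- the upper-triangular (d-1)×(d-1) lower-right block.  Entries below the
-- diagonal are zero and not stored.
UTMat : Multiplicity → ℕ → Set
UTMat Λ zero    = ⊤
UTMat Λ (suc d) = Vec (Entry Λ) (suc d) × UTMat Λ d

isZeroRow : ∀ {Λ k} → Vec (Entry Λ) k → Bool
isZeroRow []       = true
isZeroRow (e ∷ es) = (value e ≡ᵇ 0) ∧ isZeroRow es

NoZeroRow : ∀ {Λ d} → UTMat Λ d → Set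
NoZeroRow {d = zero}  _       = ⊤
NoZeroRow {d = suc d} (r , M) = T (not (isZeroRow r)) × NoZeroRow M

RowFishburn : Multiplicity → Set
RowFishburn Λ = Σ ℕ (λ d → Σ (UTMat Λ d) NoZeroRow)

rowSize : ∀ {Λ k} → Vec (Entry Λ) k → ℕ
rowSize []       = 0
rowSize (e ∷ es) = value e + rowSize es

rowOnes : ∀ {Λ k} → Vec (Entry Λ) k → ℕ
rowOnes []       = 0
rowOnes (e ∷ es) = (if value e ≡ᵇ 1 then 1 else 0) + rowOnes es

matSize : ∀ {Λ d} → UTMat Λ d → ℕ
matSize {d = zero}  _       = 0
matSize {d = suc d} (r , M) = rowSize r + matSize M

firstRowSize : ∀ {Λ d} → UTMat Λ d → ℕ
firstRowSize {d = zero}  _       = 0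
firstRowSize {d = suc d} (r , M) = rowSize r

diagSize : ∀ {Λ d} → UTMat Λ d → ℕ
diagSize {d = zero}  _       = 0
diagSize {d = suc d} (r , M) = value (head r) + diagSize M

lastColSize : ∀ {Λ d} → UTMat Λ d → ℕ
lastColSize {d = zero}  _       = 0
lastColSize {d = suc d} (r , M) = value (last r) + lastColSize M

numOnes : ∀ {Λ d} → UTMat Λ d → ℕ
numOnes {d = zero}  _       = 0
numOnes {d = suc d} (r , M) = rowOnes r + numOnes M

onFish : ∀ {Λ} → (∀ {d} → UTMat Λ d → ℕ) → RowFishburn Λ → ℕ
onFish f (d , M , _) = f M

-- Formal power series in z, v with integer coefficients:
-- F n m = [z^n v^m] F.

Series : Set
Series = ℕ → ℕ → ℤ

sumℤ : ℕ → (ℕ → ℤ) → ℤ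
sumℤ zero    f = f 0
sumℤ (suc n) f = sumℤ n f ℤ.+ f (suc n)

oneS : Series
oneS zero zero = 1ℤ
oneS _    _    = 0ℤ

constS : ℕ → Series
constS c zero zero = + c
constS c _    _    = 0ℤ

zS : Series
zS 1 0 = 1ℤ
zS _ _ = 0ℤ

vS : Series
vS 0 1 = 1ℤ
vS _ _ = 0ℤ

_⊕_ : Series → Series → Series
(F ⊕ G) n m = F n m ℤ.+ G n m

_⊖_ : Series → Series → Series
(F ⊖ G) n m = F n m ℤ.- G n m

_⊛_ : Series → Series → Series
(F ⊛ G) n m = sumℤ n (λ a → sumℤ m (λ b → F a b ℤ.* G (n ∸ a) (m ∸ b)))

infixl 6 _⊕_ _⊖_
infixl 7 _⊛_

_^S_ : Series → ℕ → Series
F ^S zero  = oneS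
F ^S suc k = (F ^S k) ⊛ F

prodS : ℕ → (ℕ → Series) → Series
prodS zero    F = oneS
prodS (suc k) F = prodS k F ⊛ F (suc k)

-- Σ_{k ≥ 0} T k, for families where T k has z-order ≥ k (so the
-- coefficient of z^n only receives contributions from k ≤ n).
sumS : (ℕ → Series) → Series
sumS T n m = sumℤ n (λ k → T k n m)

Λz : Multiplicity → Series
Λz Λ n m = if m ≡ᵇ 0 then + Λ n else 0ℤ

Λvz : Multiplicity → Series
Λvz Λ n m = if n ≡ᵇ m then + Λ n else 0ℤ

gfFirstRow : Multiplicity → Series
gfFirstRow Λ = oneS ⊕ sumS (λ k →
  ((Λvz Λ ^S suc k) ⊖ oneS) ⊛ prodS k (λ j → (Λz Λ ^S j) ⊖ oneS))

gfDiag : Multiplicity → Series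
gfDiag Λ = sumS (λ k → prodS k (λ j → (Λvz Λ ⊛ (Λz Λ ^S (j ∸ 1))) ⊖ oneS))

gfOnes : Multiplicity → Series
gfOnes Λ = sumS (λ k → prodS k (λ j →
  ((Λz Λ ⊕ constS (Λ 1) ⊛ (vS ⊖ oneS) ⊛ zS) ^S j) ⊖ oneS))

IsBGF : (Λ : Multiplicity) → (RowFishburn Λ → ℕ) → Series → Set
IsBGF Λ stat F = ∀ n m → Σ ℕ (λ c → (F n m ≡ + c) ×
  (Fin c ↔ Σ (RowFishburn Λ) (λ M → (onFish matSize M ≡ n) × (stat M ≡ m))))

module Submission where

-- The four formulas are instances of the symbolic method for classes of
-- objects weighted by a size (exponent of z) and a statistic (exponent of v).
-- A class has generating function F when every coefficient [z^n v^m] F is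
-- the number of its objects of size n and statistic m, witnessed by a
-- bijection with Fin.  This notion is invariant under isomorphism of classes
-- and turns disjoint union into ⊕, cartesian product into ⊛ (hence length-k
-- sequences into ^S k), a union of classes B k whose objects have size ≥ k
-- into sumS, and removal of the unique object of size 0 into _⊖ oneS.
--   A single entry has generating function Λ(z), Λ(vz) or Λ(z) + λ₁(v-1)z,
-- according to the statistic, so rows of length k have generating functions
-- Λ(z)^k, Λ(vz)^k, ...; as λ₀ = 1 the zero row is the only row of size 0, so
-- nonzero rows have these minus 1.  A Λ-row-Fishburn matrix of dimension d is
-- a product of nonzero rows of lengths d, ..., 1 and has size ≥ d: summing
-- over d gives (ii) and (iii), splitting off the first row gives (i).

open import Defs
open import Data.Nat using (ℕ; zero; suc; _+_; _*_; _∸_; _≤_; _<_; z≤n; s≤s; _≡ᵇ_)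
open import Data.Nat.Properties
  using (≤-irrelevant; ≡-irrelevant; m≤m+n; m≤n+m; ≤-refl; ≤-trans; m≤n⇒m≤1+n; +-mono-≤;
         +-comm; +-identityʳ; +-commutativeSemigroup;
         m+n∸m≡n; m+[n∸m]≡n; m+n∸n≡m; n∸n≡0; +-∸-assoc; <⇒≤; n≢0⇒n>0; n≮0; 0≢1+n;
         m+n≡0⇒m≡0; m+n≡0⇒n≡0; ≡ᵇ⇒≡; ≡⇒≡ᵇ)
open import Data.Integer using (ℤ; +_; -_; 0ℤ; 1ℤ; -1ℤ) renaming (_+_ to _+ℤ_; _*_ to _*ℤ_; _-_ to _-ℤ_)
import Data.Integer.Properties as ℤP
open import Algebra.Properties.CommutativeSemigroup +-commutativeSemigroup using (x∙yz≈y∙xz)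
open import Data.Fin using (Fin; zero)
open import Data.Fin.Properties using (+↔⊎; *↔×)
open import Data.Fin.Permutation using (↔⇒≡)
open import Data.Product using (Σ; _×_; _,_; proj₁; proj₂)
open import Data.Sum using (_⊎_; inj₁; inj₂; [_,_])
open import Data.Sum.Function.Propositional using (_⊎-cong_)
open import Data.Product.Function.NonDependent.Propositional using (_×-cong_)
open import Data.Empty using (⊥-elim)
open import Data.Unit using (tt)
open import Data.Bool using (true; false; T; not; if_then_else_)
open import Data.Bool.Properties using (T-irrelevant)
open import Data.Vec using (Vec; []; _∷_; head; last; init; _∷ʳ_; initLast; replicate)
open import Data.Vec.Properties using (init-∷ʳ; last-∷ʳ)
open import Function using (_∘_)
open import Function.Bundles using (_↔_; mk↔ₛ′; Inverse; _⇔_; mk⇔; Equivalence)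
open import Function.Properties.Inverse using (↔-refl; ↔-sym; ↔-trans)
open import Relation.Nullary using (¬_; Irrelevant)
open import Relation.Binary.PropositionalEquality using (_≡_; refl; sym; trans; cong; cong₂; subst; module ≡-Reasoning)

sumℤ-peel : ∀ n (f : ℕ → ℤ) → sumℤ (suc n) f ≡ f 0 +ℤ sumℤ n (f ∘ suc)
sumℤ-peel zero    f = refl
sumℤ-peel (suc n) f = trans (cong (_+ℤ f (suc (suc n))) (sumℤ-peel n f))
                            (ℤP.+-assoc (f 0) (sumℤ n (f ∘ suc)) (f (suc (suc n))))

sumℤ-zero : ∀ n {f : ℕ → ℤ} → (∀ k → k ≤ n → f k ≡ 0ℤ) → sumℤ n f ≡ 0ℤ
sumℤ-zero zero    h = h 0 z≤n
sumℤ-zero (suc n) h =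
  cong₂ _+ℤ_ (sumℤ-zero n (λ k k≤n → h k (m≤n⇒m≤1+n k≤n))) (h (suc n) ≤-refl)

sumℤ-first : ∀ n {f : ℕ → ℤ} → (∀ k → f (suc k) ≡ 0ℤ) → sumℤ n f ≡ f 0
sumℤ-first zero    h = refl
sumℤ-first (suc n) {f} h = begin
  sumℤ (suc n) f            ≡⟨ sumℤ-peel n f ⟩
  f 0 +ℤ sumℤ n (f ∘ suc)   ≡⟨ cong (f 0 +ℤ_) (sumℤ-zero n (λ k _ → h k)) ⟩
  f 0 +ℤ 0ℤ                 ≡⟨ ℤP.+-identityʳ (f 0) ⟩
  f 0                       ∎
  where open ≡-Reasoning

sumℤ-last : ∀ n {f : ℕ → ℤ} → (∀ k → k < n → f k ≡ 0ℤ) → sumℤ n f ≡ f n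
sumℤ-last zero    h = refl
sumℤ-last (suc n) {f} h =
  trans (cong (_+ℤ f (suc n)) (sumℤ-zero n (λ k k≤n → h k (s≤s k≤n)))) (ℤP.+-identityˡ (f (suc n)))

Counted : ℤ → Set → Set
Counted z X = Σ ℕ (λ c → (z ≡ + c) × (Fin c ↔ X))

counted-resp : ∀ {z z′ X Y} → z ≡ z′ → X ↔ Y → Counted z X → Counted z′ Y
counted-resp eq iso (c , e , i) = c , trans (sym eq) e , ↔-trans i iso

counted-unique : ∀ {z z′ X} → Counted z X → Counted z′ X → z ≡ z′
counted-unique (c , e , i) (c′ , e′ , i′) =
  trans e (trans (cong +_ (↔⇒≡ (↔-trans i (↔-sym i′)))) (sym e′))

counted-empty : ∀ {X} → ¬ X → Counted 0ℤ X
counted-empty ¬x = 0 , refl , mk↔ₛ′ (λ ()) (λ x → ⊥-elim (¬x x)) (λ x → ⊥-elim (¬x x)) (λ ())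

counted-single : ∀ {X} → X → Irrelevant X → Counted 1ℤ X
counted-single x irr = 1 , refl , mk↔ₛ′ (λ _ → x) (λ _ → zero) (irr x) (λ { zero → refl })

counted-⊎ : ∀ {a b X Y} → Counted a X → Counted b Y → Counted (a +ℤ b) (X ⊎ Y)
counted-⊎ (c , e , i) (d , e′ , j) =
  c + d , trans (cong₂ _+ℤ_ e e′) (sym (ℤP.pos-+ c d)) , ↔-trans +↔⊎ (i ⊎-cong j)

counted-× : ∀ {a b X Y} → Counted a X → Counted b Y → Counted (a *ℤ b) (X × Y)
counted-× (c , e , i) (d , e′ , j) =
  c * d , trans (cong₂ _*ℤ_ e e′) (sym (ℤP.pos-* c d)) , ↔-trans *↔× (i ×-cong j)

Σ≤ : ℕ → (ℕ → Set) → Set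
Σ≤ n Q = Σ ℕ (λ k → k ≤ n × Q k)

Σ≤-zero : ∀ {Q} → Σ≤ 0 Q ↔ Q 0
Σ≤-zero = mk↔ₛ′ (λ { (_ , z≤n , q) → q }) (λ q → 0 , z≤n , q)
                (λ _ → refl) (λ { (_ , z≤n , q) → refl })

Σ≤-suc : ∀ {n Q} → Σ≤ (suc n) Q ↔ (Q 0 ⊎ Σ≤ n (Q ∘ suc))
Σ≤-suc = mk↔ₛ′
  (λ { (_ , z≤n , q) → inj₁ q ; (suc k , s≤s k≤n , q) → inj₂ (k , k≤n , q) })
  (λ { (inj₁ q) → 0 , z≤n , q ; (inj₂ (k , k≤n , q)) → suc k , s≤s k≤n , q })
  (λ { (inj₁ q) → refl ; (inj₂ _) → refl })
  (λ { (_ , z≤n , q) → refl ; (suc k , s≤s k≤n , q) → refl })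

counted-Σ≤ : ∀ n {f : ℕ → ℤ} {Q} → (∀ k → k ≤ n → Counted (f k) (Q k)) → Counted (sumℤ n f) (Σ≤ n Q)
counted-Σ≤ zero    h = counted-resp refl (↔-sym Σ≤-zero) (h 0 z≤n)
counted-Σ≤ (suc n) {f} h = counted-resp (sym (sumℤ-peel n f)) (↔-sym Σ≤-suc)
  (counted-⊎ (h 0 z≤n) (counted-Σ≤ n (λ k k≤n → h (suc k) (s≤s k≤n))))

record Class : Set₁ where
  constructor mkClass
  field
    Obj  : Set
    size : Obj → ℕ
    stat : Obj → ℕ
open Class public

Fiber : Class → ℕ → ℕ → Set
Fiber W n m = Σ (Obj W) (λ a → (size W a ≡ n) × (stat W a ≡ m))

GF : Class → Series → Set
GF W F = ∀ n m → Counted (F n m) (Fiber W n m)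

fiber-≡ : ∀ W {n m} {x y : Fiber W n m} → proj₁ x ≡ proj₁ y → x ≡ y
fiber-≡ W {x = a , p , q} {y = .a , p′ , q′} refl =
  cong₂ (λ p q → a , p , q) (≡-irrelevant p p′) (≡-irrelevant q q′)

gf-≗ : ∀ {W F G} → (∀ n m → F n m ≡ G n m) → GF W F → GF W G
gf-≗ F≗G C n m = counted-resp (F≗G n m) ↔-refl (C n m)

record _≅_ (W W′ : Class) : Set where
  field
    bijection : Obj W ↔ Obj W′
    size-≡    : ∀ a → size W′ (Inverse.to bijection a) ≡ size W a
    stat-≡    : ∀ a → stat W′ (Inverse.to bijection a) ≡ stat W a

fiber-iso : ∀ {W W′} → W ≅ W′ → ∀ n m → Fiber W n m ↔ Fiber W′ n m
fiber-iso {W} {W′} iso n m = mk↔ₛ′ to′ from′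
  (λ _ → fiber-≡ W′ (strictlyInverseˡ _)) (λ _ → fiber-≡ W (strictlyInverseʳ _))
  where
  open _≅_ iso
  open Inverse bijection
  to′ : Fiber W n m → Fiber W′ n m
  to′ (a , p , q) = to a , trans (size-≡ a) p , trans (stat-≡ a) q
  from′ : Fiber W′ n m → Fiber W n m
  from′ (b , p , q) = from b ,
    trans (sym (size-≡ (from b))) (trans (cong (size W′) (strictlyInverseˡ b)) p) ,
    trans (sym (stat-≡ (from b))) (trans (cong (stat W′) (strictlyInverseˡ b)) q)

gf-≅ : ∀ {W W′ F} → W ≅ W′ → GF W F → GF W′ F
gf-≅ iso C n m = counted-resp refl (fiber-iso iso n m) (C n m)

_+ᶜ_ : Class → Class → Class
W +ᶜ W′ = mkClass (Obj W ⊎ Obj W′) [ size W , size W′ ] [ stat W , stat W′ ]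

gf-+ : ∀ {W W′ F G} → GF W F → GF W′ G → GF (W +ᶜ W′) (F ⊕ G)
gf-+ {W} {W′} C C′ n m = counted-resp refl iso (counted-⊎ (C n m) (C′ n m))
  where
  iso : (Fiber W n m ⊎ Fiber W′ n m) ↔ Fiber (W +ᶜ W′) n m
  iso = mk↔ₛ′
    (λ { (inj₁ (a , p , q)) → inj₁ a , p , q ; (inj₂ (b , p , q)) → inj₂ b , p , q })
    (λ { (inj₁ a , p , q) → inj₁ (a , p , q) ; (inj₂ b , p , q) → inj₂ (b , p , q) })
    (λ { (inj₁ _ , _) → refl ; (inj₂ _ , _) → refl })
    (λ { (inj₁ _) → refl ; (inj₂ _) → refl })

_×ᶜ_ : Class → Class → Class
W ×ᶜ W′ = mkClass (Obj W × Obj W′)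
  (λ x → size W (proj₁ x) + size W′ (proj₂ x)) (λ x → stat W (proj₁ x) + stat W′ (proj₂ x))

summand-≤ : ∀ {x y n} → x + y ≡ n → x ≤ n
summand-≤ {x} {y} e = subst (x ≤_) e (m≤m+n x y)

summand-∸ : ∀ {x y n} → x + y ≡ n → y ≡ n ∸ x
summand-∸ {x} {y} e = trans (sym (m+n∸m≡n x y)) (cong (_∸ x) e)

product-fiber : ∀ W W′ n m → Fiber (W ×ᶜ W′) n m ↔
  Σ≤ n (λ i → Σ≤ m (λ j → Fiber W i j × Fiber W′ (n ∸ i) (m ∸ j)))
product-fiber W W′ n m = mk↔ₛ′ split join split-join (λ _ → fiber-≡ (W ×ᶜ W′) refl)
  where
  split : Fiber (W ×ᶜ W′) n m → Σ≤ n (λ i → Σ≤ m (λ j → Fiber W i j × Fiber W′ (n ∸ i) (m ∸ j)))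
  split ((a , b) , p , q) =
    size W a , summand-≤ p , stat W a , summand-≤ q , (a , refl , refl) , (b , summand-∸ p , summand-∸ q)
  join : Σ≤ n (λ i → Σ≤ m (λ j → Fiber W i j × Fiber W′ (n ∸ i) (m ∸ j))) → Fiber (W ×ᶜ W′) n m
  join (_ , i≤n , _ , j≤m , (a , refl , refl) , (b , p , q)) =
    (a , b) , trans (cong (_+_ (size W a)) p) (m+[n∸m]≡n i≤n) , trans (cong (_+_ (stat W a)) q) (m+[n∸m]≡n j≤m)
  split-join : ∀ y → split (join y) ≡ y
  split-join (_ , i≤n , _ , j≤m , (a , refl , refl) , (b , p , q)) =
    cong₂ (λ (i≤n , j≤m) (p , q) → size W a , i≤n , stat W a , j≤m , (a , refl , refl) , (b , p , q))
      (cong₂ _,_ (≤-irrelevant _ _) (≤-irrelevant _ _)) (cong₂ _,_ (≡-irrelevant _ _) (≡-irrelevant _ _))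

gf-× : ∀ {W W′ F G} → GF W F → GF W′ G → GF (W ×ᶜ W′) (F ⊛ G)
gf-× {W} {W′} C C′ n m = counted-resp refl (↔-sym (product-fiber W W′ n m))
  (counted-Σ≤ n (λ i _ → counted-Σ≤ m (λ j _ → counted-× (C i j) (C′ (n ∸ i) (m ∸ j)))))

Σᶜ : (ℕ → Class) → Class
Σᶜ B = mkClass (Σ ℕ (Obj ∘ B)) (λ x → size (B (proj₁ x)) (proj₂ x)) (λ x → stat (B (proj₁ x)) (proj₂ x))

Σ-fiber : ∀ B → (∀ k b → k ≤ size (B k) b) → ∀ n m → Fiber (Σᶜ B) n m ↔ Σ≤ n (λ k → Fiber (B k) n m)
Σ-fiber B bound n m = mk↔ₛ′
  (λ { ((k , b) , p , q) → k , subst (k ≤_) p (bound k b) , b , p , q })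
  (λ { (k , _ , b , p , q) → (k , b) , p , q })
  (λ { (k , _ , b , p , q) → cong (λ k≤n → k , k≤n , b , p , q) (≤-irrelevant _ _) })
  (λ _ → refl)

gf-Σ : ∀ B {T : ℕ → Series} → (∀ k b → k ≤ size (B k) b) → (∀ k → GF (B k) (T k)) → GF (Σᶜ B) (sumS T)
gf-Σ B bound C n m = counted-resp refl (↔-sym (Σ-fiber B bound n m)) (counted-Σ≤ n (λ k _ → C k n m))

record UniqueEmpty (W : Class) : Set where
  field
    empty        : Obj W
    empty-size   : size W empty ≡ 0
    empty-stat   : stat W empty ≡ 0
    empty-unique : ∀ a → size W a ≡ 0 → a ≡ empty

size0-counted : ∀ {W} → UniqueEmpty W → ∀ m → Counted (oneS 0 m) (Fiber W 0 m)
size0-counted {W} u zero = counted-single (empty , empty-size , empty-stat)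
  (λ x y → fiber-≡ W (trans (empty-unique _ (proj₁ (proj₂ x))) (sym (empty-unique _ (proj₁ (proj₂ y))))))
  where open UniqueEmpty u
size0-counted {W} u (suc m) = counted-empty λ { (a , s , t) →
  0≢1+n (trans (sym empty-stat) (trans (cong (stat W) (sym (empty-unique a s))) t)) }
  where open UniqueEmpty u

gf-unit : ∀ {W} → UniqueEmpty W → (∀ a → size W a ≡ 0) → GF W oneS
gf-unit u all0 zero    m = size0-counted u m
gf-unit u all0 (suc n) m = counted-empty λ { (a , s , _) → 0≢1+n (trans (sym (all0 a)) s) }

_∣_ : (W : Class) → (Obj W → Set) → Class
W ∣ P = mkClass (Σ (Obj W) P) (size W ∘ proj₁) (stat W ∘ proj₁)

gf-nonempty : ∀ {W F} (P : Obj W → Set) → (∀ {a} → Irrelevant (P a)) →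
  (∀ a → P a ⇔ 0 < size W a) → UniqueEmpty W → GF W F → GF (W ∣ P) (F ⊖ oneS)
gf-nonempty {W} {F} P irr P⇔ u C zero m = counted-resp (sym F-1≡0) ↔-refl (counted-empty none)
  where
  none : ¬ Fiber (W ∣ P) 0 m
  none ((a , p) , s , _) = n≮0 (subst (0 <_) s (Equivalence.to (P⇔ a) p))
  -- the size-0 coefficients of F are those of 1, since both count Fiber W 0 m
  F-1≡0 : F 0 m -ℤ oneS 0 m ≡ 0ℤ
  F-1≡0 = trans (cong (F 0 m -ℤ_) (sym (counted-unique (C 0 m) (size0-counted u m)))) (ℤP.+-inverseʳ (F 0 m))
gf-nonempty {W} {F} P irr P⇔ u C (suc n) m =
  counted-resp (sym (ℤP.+-identityʳ (F (suc n) m))) iso (C (suc n) m)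
  where
  iso : Fiber W (suc n) m ↔ Fiber (W ∣ P) (suc n) m
  iso = mk↔ₛ′ (λ { (a , s , t) → (a , Equivalence.from (P⇔ a) (subst (0 <_) (sym s) (s≤s z≤n))) , s , t })
              (λ { ((a , _) , s , t) → a , s , t })
              (λ { ((a , _) , _) → fiber-≡ (W ∣ P) (cong (a ,_) (irr _ _)) })
              (λ _ → refl)

constS-⊛ : ∀ c G n m → (constS c ⊛ G) n m ≡ + c *ℤ G n m
constS-⊛ c G n m = begin
  (constS c ⊛ G) n m
    ≡⟨ sumℤ-first n (λ a → sumℤ-zero m (λ b _ → ℤP.*-zeroˡ (G (n ∸ suc a) (m ∸ b)))) ⟩
  sumℤ m (λ b → constS c 0 b *ℤ G n (m ∸ b))
    ≡⟨ sumℤ-first m (λ b → ℤP.*-zeroˡ (G n (m ∸ suc b))) ⟩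
  + c *ℤ G n m
    ∎
  where open ≡-Reasoning

⊛zS-zero : ∀ G m → (G ⊛ zS) 0 m ≡ 0ℤ
⊛zS-zero G m = sumℤ-zero m (λ b _ → ℤP.*-zeroʳ (G 0 b))

⊛zS-suc : ∀ G n m → (G ⊛ zS) (suc n) m ≡ G n m
⊛zS-suc G n m = begin
  sumℤ n term +ℤ term (suc n)
    ≡⟨ cong₂ _+ℤ_ (sumℤ-last n (λ a a<n → sumℤ-zero m (λ b _ → far a a<n b)))
                  (sumℤ-zero m (λ b _ → past b)) ⟩
  term n +ℤ 0ℤ
    ≡⟨ ℤP.+-identityʳ (term n) ⟩
  term n
    ≡⟨ sumℤ-last m (λ b b<m → late b b<m) ⟩
  G n m *ℤ zS (suc n ∸ n) (m ∸ m)
    ≡⟨ cong₂ (λ i j → G n m *ℤ zS i j) (m+n∸n≡m 1 n) (n∸n≡0 m) ⟩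
  G n m *ℤ 1ℤ
    ≡⟨ ℤP.*-identityʳ (G n m) ⟩
  G n m
    ∎
  where
  open ≡-Reasoning
  term : ℕ → ℤ
  term a = sumℤ m (λ b → G a b *ℤ zS (suc n ∸ a) (m ∸ b))
  -- a < n leaves a z-exponent ≥ 2 for zS
  far : ∀ a → a < n → ∀ b → G a b *ℤ zS (suc n ∸ a) (m ∸ b) ≡ 0ℤ
  far a a<n b = trans (cong (λ i → G a b *ℤ zS i (m ∸ b)) two-more) (ℤP.*-zeroʳ (G a b))
    where
    two-more : suc n ∸ a ≡ suc (suc (n ∸ suc a))
    two-more = trans (+-∸-assoc 1 (<⇒≤ a<n)) (cong suc (+-∸-assoc 1 a<n))
  past : ∀ b → G (suc n) b *ℤ zS (n ∸ n) (m ∸ b) ≡ 0ℤ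
  past b = trans (cong (λ i → G (suc n) b *ℤ zS i (m ∸ b)) (n∸n≡0 n)) (ℤP.*-zeroʳ (G (suc n) b))
  late : ∀ b → b < m → G n b *ℤ zS (suc n ∸ n) (m ∸ b) ≡ 0ℤ
  late b b<m = trans (cong₂ (λ i j → G n b *ℤ zS i j) (m+n∸n≡m 1 n) (+-∸-assoc 1 b<m)) (ℤP.*-zeroʳ (G n b))

sumV : ∀ {A : Set} {k} → (A → ℕ) → Vec A k → ℕ
sumV f []       = 0
sumV f (x ∷ xs) = f x + sumV f xs

Seq : Class → ℕ → Class
Seq W k = mkClass (Vec (Obj W) k) (sumV (size W)) (sumV (stat W))

gf-Seq : ∀ {W F} → GF W F → ∀ k → GF (Seq W k) (F ^S k)
gf-Seq {W} C zero = gf-unit nil (λ { [] → refl })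
  where
  nil : UniqueEmpty (Seq W 0)
  nil = record { empty = [] ; empty-size = refl ; empty-stat = refl ; empty-unique = λ { [] _ → refl } }
gf-Seq {W} C (suc k) = gf-≅ cons (gf-× (gf-Seq C k) C)
  where
  cons : (Seq W k ×ᶜ W) ≅ Seq W (suc k)
  cons = record
    { bijection = mk↔ₛ′ (λ p → proj₂ p ∷ proj₁ p) (λ { (x ∷ xs) → xs , x })
                        (λ { (x ∷ xs) → refl }) (λ _ → refl)
    ; size-≡    = λ (xs , x) → +-comm (size W x) (sumV (size W) xs)
    ; stat-≡    = λ (xs , x) → +-comm (stat W x) (sumV (stat W) xs) }

isOne : ℕ → ℕ
isOne i = if i ≡ᵇ 1 then 1 else 0

-- Entries, rows and matrices over Λ; nothing here uses λ₀ = 1.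
module Matrices (Λ : Multiplicity) where

  EntryClass : (ℕ → ℕ) → Class
  EntryClass h = mkClass (Entry Λ) value (h ∘ value)

  entryGF : (ℕ → ℕ) → Series
  entryGF h n m = if h n ≡ᵇ m then + Λ n else 0ℤ

  gf-entry : ∀ h → GF (EntryClass h) (entryGF h)
  gf-entry h n m with h n ≡ᵇ m in eq
  ... | true  = Λ n , refl , mk↔ₛ′
    (λ x → (n , x) , refl , ≡ᵇ⇒≡ (h n) m (subst T (sym eq) tt))
    (λ { ((_ , x) , refl , _) → x })
    (λ { ((_ , x) , refl , _) → fiber-≡ (EntryClass h) refl })
    (λ _ → refl)
  ... | false = counted-empty λ { ((_ , x) , refl , t) → subst T eq (≡⇒≡ᵇ (h n) m t) }

  Λz-entry : ∀ n m → Λz Λ n m ≡ entryGF (λ _ → 0) n m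
  Λz-entry n zero    = refl
  Λz-entry n (suc m) = refl

  correction : Series
  correction = constS (Λ 1) ⊛ (vS ⊖ oneS) ⊛ zS

  correction-suc : ∀ n m → correction (suc n) m ≡ + Λ 1 *ℤ (vS ⊖ oneS) n m
  correction-suc n m =
    trans (⊛zS-suc (constS (Λ 1) ⊛ (vS ⊖ oneS)) n m) (constS-⊛ (Λ 1) (vS ⊖ oneS) n m)

  ΛOnes : Series
  ΛOnes = Λz Λ ⊕ correction

  ΛOnes-entry : ∀ n m → ΛOnes n m ≡ entryGF isOne n m
  ΛOnes-entry zero m = begin
    Λz Λ 0 m +ℤ correction 0 m   ≡⟨ cong (Λz Λ 0 m +ℤ_) (⊛zS-zero (constS (Λ 1) ⊛ (vS ⊖ oneS)) m) ⟩
    Λz Λ 0 m +ℤ 0ℤ               ≡⟨ ℤP.+-identityʳ (Λz Λ 0 m) ⟩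
    Λz Λ 0 m                     ≡⟨ Λz-entry 0 m ⟩
    entryGF isOne 0 m            ∎
    where open ≡-Reasoning
  ΛOnes-entry (suc n) m = trans (cong (Λz Λ (suc n) m +ℤ_) (correction-suc n m)) (positive n m)
    where
    open ≡-Reasoning
    -- at z¹ the two terms cancel for v⁰ and the correction supplies v¹
    positive : ∀ n m → Λz Λ (suc n) m +ℤ + Λ 1 *ℤ (vS ⊖ oneS) n m ≡ entryGF isOne (suc n) m
    positive zero zero = begin
      + Λ 1 +ℤ + Λ 1 *ℤ -1ℤ   ≡⟨ cong (+ Λ 1 +ℤ_) (trans (ℤP.*-comm (+ Λ 1) -1ℤ) (ℤP.-1*i≡-i (+ Λ 1))) ⟩
      + Λ 1 +ℤ - + Λ 1        ≡⟨ ℤP.+-inverseʳ (+ Λ 1) ⟩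
      0ℤ                      ∎
    positive zero (suc zero)    = trans (ℤP.+-identityˡ _) (ℤP.*-identityʳ (+ Λ 1))
    positive zero (suc (suc m)) = trans (ℤP.+-identityˡ _) (ℤP.*-zeroʳ (+ Λ 1))
    positive (suc n) m = begin
      Λz Λ (suc (suc n)) m +ℤ + Λ 1 *ℤ 0ℤ   ≡⟨ cong (Λz Λ (suc (suc n)) m +ℤ_) (ℤP.*-zeroʳ (+ Λ 1)) ⟩
      Λz Λ (suc (suc n)) m +ℤ 0ℤ            ≡⟨ ℤP.+-identityʳ _ ⟩
      Λz Λ (suc (suc n)) m                  ≡⟨ Λz-entry (suc (suc n)) m ⟩
      entryGF isOne (suc (suc n)) m         ∎

  gf-entry-plain : GF (EntryClass (λ _ → 0)) (Λz Λ)
  gf-entry-plain = gf-≗ (λ n m → sym (Λz-entry n m)) (gf-entry (λ _ → 0))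

  gf-entry-ones : GF (EntryClass isOne) ΛOnes
  gf-entry-ones = gf-≗ (λ n m → sym (ΛOnes-entry n m)) (gf-entry isOne)

  Row : ∀ k → (Vec (Entry Λ) k → ℕ) → Class
  Row k s = mkClass (Vec (Entry Λ) k) rowSize s

  rowSize-sumV : ∀ {k} (r : Vec (Entry Λ) k) → rowSize r ≡ sumV value r
  rowSize-sumV []       = refl
  rowSize-sumV (e ∷ es) = cong (_+_ (value e)) (rowSize-sumV es)

  gf-row : ∀ h {F} k (s : Vec (Entry Λ) k → ℕ) → (∀ r → s r ≡ sumV (h ∘ value) r) →
    GF (EntryClass h) F → GF (Row k s) (F ^S k)
  gf-row h k s s≡ C = gf-≅ iso (gf-Seq C k)
    where
    iso : Seq (EntryClass h) k ≅ Row k s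
    iso = record { bijection = ↔-refl ; size-≡ = rowSize-sumV ; stat-≡ = s≡ }

  gf-row-plain : ∀ k → GF (Row k (λ _ → 0)) (Λz Λ ^S k)
  gf-row-plain k = gf-row (λ _ → 0) k _ zero-sum gf-entry-plain
    where
    zero-sum : ∀ {k} (r : Vec (Entry Λ) k) → 0 ≡ sumV (λ _ → 0) r
    zero-sum []       = refl
    zero-sum (e ∷ es) = zero-sum es

  gf-row-size : ∀ k → GF (Row k rowSize) (Λvz Λ ^S k)
  gf-row-size k = gf-row (λ i → i) k rowSize rowSize-sumV (gf-entry (λ i → i))

  gf-row-ones : ∀ k → GF (Row k rowOnes) (ΛOnes ^S k)
  gf-row-ones k = gf-row isOne k rowOnes ones-sum gf-entry-ones
    where
    ones-sum : ∀ {k} (r : Vec (Entry Λ) k) → rowOnes r ≡ sumV (isOne ∘ value) r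
    ones-sum []       = refl
    ones-sum (e ∷ es) = cong (_+_ (isOne (value e))) (ones-sum es)

  gf-row-head : ∀ j → GF (Row (suc j) (value ∘ head)) (Λvz Λ ⊛ (Λz Λ ^S j))
  gf-row-head j = gf-≅ iso (gf-× (gf-entry (λ i → i)) (gf-row-plain j))
    where
    iso : (EntryClass (λ i → i) ×ᶜ Row j (λ _ → 0)) ≅ Row (suc j) (value ∘ head)
    iso = record
      { bijection = mk↔ₛ′ (λ p → proj₁ p ∷ proj₂ p) (λ { (x ∷ xs) → x , xs })
                          (λ { (x ∷ xs) → refl }) (λ _ → refl)
      ; size-≡    = λ _ → refl
      ; stat-≡    = λ (x , _) → sym (+-identityʳ (value x)) }

  rowSize-∷ʳ : ∀ {k} (xs : Vec (Entry Λ) k) x → rowSize (xs ∷ʳ x) ≡ value x + rowSize xs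
  rowSize-∷ʳ []       x = refl
  rowSize-∷ʳ (y ∷ ys) x =
    trans (cong (_+_ (value y)) (rowSize-∷ʳ ys x)) (x∙yz≈y∙xz (value y) (value x) (rowSize ys))

  gf-row-last : ∀ j → GF (Row (suc j) (value ∘ last)) (Λvz Λ ⊛ (Λz Λ ^S j))
  gf-row-last j = gf-≅ iso (gf-× (gf-entry (λ i → i)) (gf-row-plain j))
    where
    iso : (EntryClass (λ i → i) ×ᶜ Row j (λ _ → 0)) ≅ Row (suc j) (value ∘ last)
    iso = record
      { bijection = mk↔ₛ′ (λ p → proj₂ p ∷ʳ proj₁ p) (λ r → last r , init r)
                          (λ r → sym (proj₂ (proj₂ (initLast r))))
                          (λ (x , xs) → cong₂ _,_ (last-∷ʳ x xs) (init-∷ʳ x xs))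
      ; size-≡    = λ (x , xs) → rowSize-∷ʳ xs x
      ; stat-≡    = λ (x , xs) → trans (cong value (last-∷ʳ x xs)) (sym (+-identityʳ (value x))) }

  NonZeroRow : ∀ {k} → Vec (Entry Λ) k → Set
  NonZeroRow r = T (not (isZeroRow r))

  zeroRow⇒size0 : ∀ {k} (r : Vec (Entry Λ) k) → isZeroRow r ≡ true → rowSize r ≡ 0
  zeroRow⇒size0 []                 _ = refl
  zeroRow⇒size0 ((zero , _) ∷ es)  h = zeroRow⇒size0 es h
  zeroRow⇒size0 ((suc _ , _) ∷ _) ()

  size0⇒zeroRow : ∀ {k} (r : Vec (Entry Λ) k) → rowSize r ≡ 0 → isZeroRow r ≡ true
  size0⇒zeroRow []                 _ = refl
  size0⇒zeroRow ((zero , _) ∷ es)  h = size0⇒zeroRow es h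
  size0⇒zeroRow ((suc _ , _) ∷ _) ()

  nonZeroRow⇔positive : ∀ {k} (r : Vec (Entry Λ) k) → NonZeroRow r ⇔ 0 < rowSize r
  nonZeroRow⇔positive r = mk⇔
    (λ nz → n≢0⇒n>0 (λ s≡0 → subst (T ∘ not) (size0⇒zeroRow r s≡0) nz))
    (λ pos → nonzero pos)
    where
    nonzero : 0 < rowSize r → NonZeroRow r
    nonzero pos with isZeroRow r in eq
    ... | true  = ⊥-elim (n≮0 (subst (0 <_) (zeroRow⇒size0 r eq) pos))
    ... | false = tt

  RowStat : Set
  RowStat = ∀ {k} → Vec (Entry Λ) (suc k) → ℕ

  MatStat : Set
  MatStat = ∀ {d} → UTMat Λ d → ℕ

  record RowSum (rs : RowStat) (st : MatStat) : Set where
    field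
      sum-empty : st {0} tt ≡ 0
      sum-rows  : ∀ {d} (r : Vec (Entry Λ) (suc d)) (M : UTMat Λ d) → st (r , M) ≡ rs r + st M

  NZRow : ∀ k → (Vec (Entry Λ) k → ℕ) → Class
  NZRow k s = Row k s ∣ NonZeroRow

  Mat : MatStat → ℕ → Class
  Mat st d = mkClass (Σ (UTMat Λ d) NoZeroRow) (matSize ∘ proj₁) (st ∘ proj₁)

  gf-Mat : ∀ (rs : RowStat) (st : MatStat) {R : ℕ → Series} → RowSum rs st →
    (∀ j → GF (NZRow (suc j) rs) (R (suc j))) → ∀ d → GF (Mat st d) (prodS d R)
  gf-Mat rs st sum C zero = gf-unit empty-matrix (λ _ → refl)
    where
    empty-matrix : UniqueEmpty (Mat st 0)
    empty-matrix = record { empty = tt , tt ; empty-size = refl ; empty-stat = RowSum.sum-empty sum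
                          ; empty-unique = λ _ _ → refl }
  gf-Mat rs st sum C (suc d) = gf-≅ iso (gf-× (gf-Mat rs st sum C d) (C d))
    where
    iso : (Mat st d ×ᶜ NZRow (suc d) rs) ≅ Mat st (suc d)
    iso = record
      { bijection = mk↔ₛ′ (λ { ((M , q) , (r , p)) → (r , M) , (p , q) })
                          (λ { ((r , M) , (p , q)) → (M , q) , (r , p) }) (λ _ → refl) (λ _ → refl)
      ; size-≡    = λ { ((M , _) , (r , _)) → +-comm (rowSize r) (matSize M) }
      ; stat-≡    = λ { ((M , _) , (r , _)) → trans (RowSum.sum-rows sum r M) (+-comm (rs r) (st M)) } }

  -- Every row is nonzero, so a matrix of dimension d has size at least d.
  dim≤size : ∀ d (M : Σ (UTMat Λ d) NoZeroRow) → d ≤ matSize (proj₁ M)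
  dim≤size zero    _                  = z≤n
  dim≤size (suc d) ((r , M) , (p , q)) =
    +-mono-≤ (Equivalence.to (nonZeroRow⇔positive r) p) (dim≤size d (M , q))

  gf-Fishburn : ∀ (rs : RowStat) (st : MatStat) {R : ℕ → Series} → RowSum rs st →
    (∀ j → GF (NZRow (suc j) rs) (R (suc j))) → IsBGF Λ (onFish st) (sumS (λ d → prodS d R))
  gf-Fishburn rs st sum C = gf-Σ (Mat st) dim≤size (gf-Mat rs st sum C)

Fin1-irrelevant : Irrelevant (Fin 1)
Fin1-irrelevant zero zero = refl

-- With λ₀ = 1 the zero row is the only row of size 0.
module Fishburn (Λ : Multiplicity) (λ₀≡1 : Λ 0 ≡ 1) where
  open Matrices Λ

  zeroEntry : Entry Λ
  zeroEntry = 0 , subst Fin (sym λ₀≡1) zero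

  zeroRow : ∀ k → Vec (Entry Λ) k
  zeroRow k = replicate k zeroEntry

  value0-unique : ∀ (e : Entry Λ) → value e ≡ 0 → e ≡ zeroEntry
  value0-unique (_ , x) refl = cong (0 ,_) (subst (Irrelevant ∘ Fin) (sym λ₀≡1) Fin1-irrelevant x _)

  size0-unique : ∀ {k} (r : Vec (Entry Λ) k) → rowSize r ≡ 0 → r ≡ zeroRow k
  size0-unique []       _ = refl
  size0-unique (e ∷ es) h =
    cong₂ _∷_ (value0-unique e (m+n≡0⇒m≡0 (value e) h)) (size0-unique es (m+n≡0⇒n≡0 (value e) h))

  rowSize-zeroRow : ∀ k → rowSize (zeroRow k) ≡ 0
  rowSize-zeroRow zero    = refl
  rowSize-zeroRow (suc k) = rowSize-zeroRow k

  rowOnes-zeroRow : ∀ k → rowOnes (zeroRow k) ≡ 0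
  rowOnes-zeroRow zero    = refl
  rowOnes-zeroRow (suc k) = rowOnes-zeroRow k

  last-zeroRow : ∀ k → value (last (zeroRow (suc k))) ≡ 0
  last-zeroRow zero    = refl
  last-zeroRow (suc k) = last-zeroRow k

  gf-nonzero-row : ∀ k (s : Vec (Entry Λ) k → ℕ) {F} → s (zeroRow k) ≡ 0 →
    GF (Row k s) F → GF (NZRow k s) (F ⊖ oneS)
  gf-nonzero-row k s s0 = gf-nonempty NonZeroRow T-irrelevant nonZeroRow⇔positive zero-row
    where
    zero-row : UniqueEmpty (Row k s)
    zero-row = record { empty = zeroRow k ; empty-size = rowSize-zeroRow k ; empty-stat = s0
                      ; empty-unique = size0-unique }

  plain-sum : RowSum (λ _ → 0) (λ _ → 0)
  plain-sum = record { sum-empty = refl ; sum-rows = λ _ _ → refl }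

  gf-plain-Mat : ∀ d → GF (Mat (λ _ → 0) d) (prodS d (λ j → (Λz Λ ^S j) ⊖ oneS))
  gf-plain-Mat = gf-Mat (λ _ → 0) (λ _ → 0) plain-sum
    (λ j → gf-nonzero-row (suc j) (λ _ → 0) refl (gf-row-plain (suc j)))

  -- (i): a matrix is empty, or a nonzero first row of length k + 1 marked by
  -- its size on top of a plain matrix of dimension k.
  FirstRowRest : ℕ → Class
  FirstRowRest k = NZRow (suc k) rowSize ×ᶜ Mat (λ _ → 0) k

  FirstRowSplit : Class
  FirstRowSplit = Mat (λ _ → 0) 0 +ᶜ Σᶜ FirstRowRest

  first-row-split : FirstRowSplit ≅ mkClass (RowFishburn Λ) (onFish matSize) (onFish firstRowSize)
  first-row-split = record
    { bijection = mk↔ₛ′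
        (λ { (inj₁ M) → 0 , M ; (inj₂ (k , (r , p) , (M , q))) → suc k , (r , M) , (p , q) })
        (λ { (zero , M) → inj₁ M ; (suc k , (r , M) , (p , q)) → inj₂ (k , (r , p) , (M , q)) })
        (λ { (zero , _) → refl ; (suc k , _) → refl })
        (λ { (inj₁ _) → refl ; (inj₂ _) → refl })
    ; size-≡ = λ { (inj₁ _) → refl ; (inj₂ _) → refl }
    ; stat-≡ = λ { (inj₁ _) → refl ; (inj₂ (k , (r , _) , _)) → sym (+-identityʳ (rowSize r)) } }

  first-row-gf : IsBGF Λ (onFish firstRowSize) (gfFirstRow Λ)
  first-row-gf = gf-≅ first-row-split (gf-+ (gf-plain-Mat 0) (gf-Σ FirstRowRest rest-bound gf-rest))
    where
    gf-rest : ∀ k → GF (FirstRowRest k) (((Λvz Λ ^S suc k) ⊖ oneS) ⊛ prodS k (λ j → (Λz Λ ^S j) ⊖ oneS))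
    gf-rest k = gf-× (gf-nonzero-row (suc k) rowSize (rowSize-zeroRow (suc k)) (gf-row-size (suc k)))
                     (gf-plain-Mat k)
    rest-bound : ∀ k x → k ≤ size (FirstRowRest k) x
    rest-bound k ((r , _) , M) = ≤-trans (dim≤size k M) (m≤n+m (matSize (proj₁ M)) (rowSize r))

  diag-gf : IsBGF Λ (onFish diagSize) (gfDiag Λ)
  diag-gf = gf-Fishburn (value ∘ head) diagSize (record { sum-empty = refl ; sum-rows = λ _ _ → refl })
    (λ j → gf-nonzero-row (suc j) (value ∘ head) refl (gf-row-head j))

  last-column-gf : IsBGF Λ (onFish lastColSize) (gfDiag Λ)
  last-column-gf = gf-Fishburn (value ∘ last) lastColSize (record { sum-empty = refl ; sum-rows = λ _ _ → refl })
    (λ j → gf-nonzero-row (suc j) (value ∘ last) (last-zeroRow j) (gf-row-last j))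

  ones-gf : IsBGF Λ (onFish numOnes) (gfOnes Λ)
  ones-gf = gf-Fishburn rowOnes numOnes (record { sum-empty = refl ; sum-rows = λ _ _ → refl })
    (λ j → gf-nonzero-row (suc j) rowOnes (rowOnes-zeroRow (suc j)) (gf-row-ones (suc j)))

proposition2p5 : (Λ : Multiplicity) → Λ 0 ≡ 1 → 0 < Λ 1 →
      IsBGF Λ (onFish firstRowSize) (gfFirstRow Λ)
    × IsBGF Λ (onFish diagSize) (gfDiag Λ)
    × IsBGF Λ (onFish lastColSize) (gfDiag Λ)
    × IsBGF Λ (onFish numOnes) (gfOnes Λ)
proposition2p5 Λ λ₀≡1 _ = first-row-gf , diag-gf , last-column-gf , ones-gf
  where open Fishburn Λ λ₀≡1
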